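{- $\mathbf{BiInt}$ has the analytic cut property: every sequent provable in $\mathbf{BiInt}$ has a locally analytic $\mathbf{BiInt}$-proof.
   Context: Formulas are built from propositional atoms and constants $\top,\bot$ using binary connectives $\land,\lor,\supset$ (implication) and $\prec$ (coimplication). A sequent is $\Gamma\Rightarrow\Delta$ with $\Gamma,\Delta$ finite multisets of formulas. The calculus $\mathbf{BiInt}$ has the following rules (in each, $\Gamma,\Delta$ are arbitrary multisets, $p$ an atom): initial sequents $\Gamma,p\Rightarrow p,\Delta$; cut: from $\Gamma\Rightarrow A,\Delta$ and $\Gamma,A\Rightarrow\Delta$ infer $\Gamma\Rightarrow\Delta$; left/right weakening and left/right contraction; $\top_L$: from $\Gamma\Rightarrow\Delta$ infer $\Gamma,\top\Rightarrow\Delta$; $\top_R$: $\Gamma\Rightarrow\top,\Delta$ is an axiom; $\bot_L$: $\Gamma,\bot\Rightarrow\Delta$ is an axiom; $\bot_R$: from $\Gamma\Rightarrow\Delta$ infer $\Gamma\Rightarrow\bot,\Delta$; $\land_L$: from $\Gamma,A,B\Rightarrow\Delta$ infer $\Gamma,A\land B\Rightarrow\Delta$; $\land_R$: from $\Gamma\Rightarrow A,\Delta$ and $\Gamma\Rightarrow B,\Delta$ infer $\Gamma\Rightarrow A\land B,\Delta$; $\lor_L$: from $\Gamma,A\Rightarrow\Delta$ and $\Gamma,B\Rightarrow\Delta$ infer $\Gamma,A\lor B\Rightarrow\Delta$; $\lor_R$: from $\Gamma\Rightarrow A,B,\Delta$ infer $\Gamma\Rightarrow A\lor B,\Delta$;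 $\supset_L$: from $\Gamma,A\supset B\Rightarrow A,\Delta$ and $\Gamma,A\supset B,B\Rightarrow\Delta$ infer $\Gamma,A\supset B\Rightarrow\Delta$; $\supset_R$: from $\Gamma,A\Rightarrow B$ infer $\Gamma\Rightarrow A\supset B,\Delta$; $\prec_L$: from $A\Rightarrow B,\Delta$ infer $\Gamma,A\prec B\Rightarrow\Delta$; $\prec_R$: from $\Gamma\Rightarrow A,A\prec B,\Delta$ and $\Gamma,B\Rightarrow A\prec B,\Delta$ infer $\Gamma\Rightarrow A\prec B,\Delta$. A proof is a finite tree of rule instances whose leaves are axioms. An instance of cut with conclusion $\Gamma\Rightarrow\Delta$ and cut-formula $A$ is analytic if $A$ is a subformula of some formula in $\Gamma\cup\Delta$. A proof is locally analytic if every cut in it is analytic. -}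

module Defs where

open import Data.Nat using (ℕ)
open import Data.List using (List; []; _∷_; [_])
open import Data.List.Membership.Propositional using (_∈_)
open import Data.List.Relation.Binary.Permutation.Propositional using (_↭_)
open import Data.Product using (∃; _×_)
open import Data.Sum using (_⊎_)
open import Data.Unit using (⊤)

data Fml : Set where
  atom : ℕ → Fml
  top  : Fml
  bot  : Fml
  _∧_  : Fml → Fml → Fml
  _∨_  : Fml → Fml → Fml
  _⊃_  : Fml → Fml → Fml
  _≺_  : Fml → Fml → Fml

infixr 6 _∧_
infixr 5 _∨_
infixr 4 _⊃_
infixr 4 _≺_

data _⊑_ : Fml → Fml → Set where
  ⊑-refl : ∀ {A} → A ⊑ A
  ⊑-∧l : ∀ {A B C} → A ⊑ B → A ⊑ (B ∧ C)
  ⊑-∧r : ∀ {A B C} → A ⊑ C → A ⊑ (B ∧ C)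
  ⊑-∨l : ∀ {A B C} → A ⊑ B → A ⊑ (B ∨ C)
  ⊑-∨r : ∀ {A B C} → A ⊑ C → A ⊑ (B ∨ C)
  ⊑-⊃l : ∀ {A B C} → A ⊑ B → A ⊑ (B ⊃ C)
  ⊑-⊃r : ∀ {A B C} → A ⊑ C → A ⊑ (B ⊃ C)
  ⊑-≺l : ∀ {A B C} → A ⊑ B → A ⊑ (B ≺ C)
  ⊑-≺r : ∀ {A B C} → A ⊑ C → A ⊑ (B ≺ C)

-- Multisets are represented by lists taken up to permutation (rule `exch`).
Ctx : Set
Ctx = List Fml

-- A condition on cut instances: given the conclusion Γ ⇒ Δ and cut formula A.
CutCond : Set₁
CutCond = Ctx → Ctx → Fml → Set

-- BiInt-proofs whose cuts all satisfy the condition K.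
-- Γ , A  is written  A ∷ Γ  (and similarly on the right).
data Proof (K : CutCond) : Ctx → Ctx → Set where
  exch : ∀ {Γ Γ' Δ Δ'} → Γ ↭ Γ' → Δ ↭ Δ' → Proof K Γ Δ → Proof K Γ' Δ'
  init : ∀ {Γ Δ} p → Proof K (atom p ∷ Γ) (atom p ∷ Δ)
  cut  : ∀ {Γ Δ} A → K Γ Δ A →
         Proof K Γ (A ∷ Δ) → Proof K (A ∷ Γ) Δ → Proof K Γ Δ
  wL   : ∀ {Γ Δ} A → Proof K Γ Δ → Proof K (A ∷ Γ) Δ
  wR   : ∀ {Γ Δ} A → Proof K Γ Δ → Proof K Γ (A ∷ Δ)
  cL   : ∀ {Γ Δ} A → Proof K (A ∷ A ∷ Γ) Δ → Proof K (A ∷ Γ) Δ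
  cR   : ∀ {Γ Δ} A → Proof K Γ (A ∷ A ∷ Δ) → Proof K Γ (A ∷ Δ)
  topL : ∀ {Γ Δ} → Proof K Γ Δ → Proof K (top ∷ Γ) Δ
  topR : ∀ {Γ Δ} → Proof K Γ (top ∷ Δ)
  botL : ∀ {Γ Δ} → Proof K (bot ∷ Γ) Δ
  botR : ∀ {Γ Δ} → Proof K Γ Δ → Proof K Γ (bot ∷ Δ)
  ∧L   : ∀ {Γ Δ A B} → Proof K (A ∷ B ∷ Γ) Δ → Proof K ((A ∧ B) ∷ Γ) Δ
  ∧R   : ∀ {Γ Δ A B} → Proof K Γ (A ∷ Δ) → Proof K Γ (B ∷ Δ) → Proof K Γ ((A ∧ B) ∷ Δ)
  ∨L   : ∀ {Γ Δ A B} → Proof K (A ∷ Γ) Δ → Proof K (B ∷ Γ) Δ → Proof K ((A ∨ B) ∷ Γ) Δ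
  ∨R   : ∀ {Γ Δ A B} → Proof K Γ (A ∷ B ∷ Δ) → Proof K Γ ((A ∨ B) ∷ Δ)
  ⊃L   : ∀ {Γ Δ A B} → Proof K ((A ⊃ B) ∷ Γ) (A ∷ Δ) → Proof K (B ∷ (A ⊃ B) ∷ Γ) Δ →
         Proof K ((A ⊃ B) ∷ Γ) Δ
  ⊃R   : ∀ {Γ Δ A B} → Proof K (A ∷ Γ) [ B ] → Proof K Γ ((A ⊃ B) ∷ Δ)
  ≺L   : ∀ {Γ Δ A B} → Proof K [ A ] (B ∷ Δ) → Proof K ((A ≺ B) ∷ Γ) Δ
  ≺R   : ∀ {Γ Δ A B} → Proof K Γ (A ∷ (A ≺ B) ∷ Δ) → Proof K (B ∷ Γ) ((A ≺ B) ∷ Δ) →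
         Proof K Γ ((A ≺ B) ∷ Δ)

anyCut : CutCond
anyCut _ _ _ = ⊤

analytic : CutCond
analytic Γ Δ A = ∃ λ C → ((C ∈ Γ) ⊎ (C ∈ Δ)) × A ⊑ C

BiIntProof : Ctx → Ctx → Set
BiIntProof = Proof anyCut

LocallyAnalyticProof : Ctx → Ctx → Set
LocallyAnalyticProof = Proof analytic

-- Every BiInt-provable sequent is valid in all Kripke models (with A ≺ B forced at w when some
-- world below w forces A but not B), so it suffices to refute in some Kripke model every
-- sequent Γ ⇒ Δ without a locally analytic proof. Let U be the subformulas of Γ ⇒ Δ. There are
-- finitely many sequents over U, so we can compute which of them are derivable from basic
-- axioms by ⊃R, ≺L and cuts on subformulas of the conclusion; such derivations are locally
-- analytic. An underivable sequent extends, one formula of U at a time, to an underivable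
-- sequent that decides every subformula of its members: if adding A on either side made it
-- derivable, an analytic cut on A would derive it. These saturated sequents, ordered by growing
-- left and shrinking right sides, form a Kripke model in which each of them forces its left
-- formulas and refutes its right ones; in particular the extension of Γ ⇒ Δ refutes it.

module Submission where

open import Defs
open import Data.Bool as Bool using (Bool; true; false; if_then_else_)
open import Data.Empty using (⊥; ⊥-elim)
open import Data.Fin using (Fin; zero; suc)
import Data.Fin.Properties as Fin
open import Data.Fin.Subset using (Subset; inside; outside; _∪_; ⁅_⁆) renaming (_∈_ to _∈ₛ_; _⊆_ to _⊆ₛ_)
open import Data.Fin.Subset.Properties using (x∈p∪q⁻; x∈p∪q⁺; x∈⁅x⁆; x∈⁅y⁆⇒x≡y; p⊆p∪q)
open import Data.List using (List; []; _∷_; [_]; _++_; foldl; length; lookup; map; cartesianProduct; allFin)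
import Data.List.Properties as Listₚ
open import Data.List.Membership.Propositional using (_∈_; find; lose)
open import Data.List.Membership.Propositional.Properties using (∈-++⁺ˡ; ∈-++⁺ʳ; ∈-++⁻; ∈-∃++; ∈-map⁺; ∈-lookup; ∈-cartesianProduct⁺; ∈-allFin)
open import Data.List.Relation.Unary.All as All using (All; []; _∷_; all?)
open import Data.List.Relation.Unary.Any as Any using (Any; here; there; any?)
open import Data.List.Relation.Unary.Any.Properties using (lookup-index)
open import Data.List.Relation.Binary.Permutation.Propositional using (refl; prep; swap; ↭-sym)
open import Data.List.Relation.Binary.Permutation.Propositional.Properties using (shift; ++-comm; All-resp-↭)
open import Data.List.Relation.Binary.Subset.Propositional using (_⊆_)
open import Data.List.Relation.Binary.Subset.Propositional.Properties using (⊆-refl)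
open import Data.Nat as ℕ using (ℕ; zero; suc; z≤n; s≤s)
open import Data.Nat.Induction using (<-wellFounded)
open import Data.Nat.Properties using (m≤n⇒m≤1+n)
open import Data.Product using (Σ; ∃; _×_; _,_; proj₁; proj₂)
import Data.Product.Properties as Productₚ
open import Data.Sum as Sum using (_⊎_; inj₁; inj₂)
import Data.Sum.Properties as Sumₚ
open import Data.Unit using (⊤; tt)
import Data.Vec.Base as Vec
open import Data.Vec.Base using ([]; _∷_)
import Data.Vec.Properties as Vecₚ
open import Function using (_∘_; id)
open import Induction.WellFounded using (Acc; acc)
open import Relation.Binary.Definitions using (DecidableEquality)
open import Relation.Binary.PropositionalEquality using (_≡_; refl; sym; trans; cong; module ≡-Reasoning)
open import Relation.Nullary using (¬_; Dec; yes; no; does; contradiction)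
open import Relation.Nullary.Decidable using (map′; _⊎-dec_; _×-dec_; dec-true)

-- Decidable equality of formulas

Token : Set
Token = ℕ ⊎ ℕ

postfix : Fml → List Token
postfix (atom p) = [ inj₁ p ]
postfix top = [ inj₂ 0 ]
postfix bot = [ inj₂ 1 ]
postfix (A ∧ B) = postfix A ++ postfix B ++ [ inj₂ 2 ]
postfix (A ∨ B) = postfix A ++ postfix B ++ [ inj₂ 3 ]
postfix (A ⊃ B) = postfix A ++ postfix B ++ [ inj₂ 4 ]
postfix (A ≺ B) = postfix A ++ postfix B ++ [ inj₂ 5 ]

push : List Fml → Token → List Fml
push s (inj₁ p) = atom p ∷ s
push s (inj₂ 0) = top ∷ s
push s (inj₂ 1) = bot ∷ s
push (B ∷ A ∷ s) (inj₂ 2) = (A ∧ B) ∷ s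
push (B ∷ A ∷ s) (inj₂ 3) = (A ∨ B) ∷ s
push (B ∷ A ∷ s) (inj₂ 4) = (A ⊃ B) ∷ s
push (B ∷ A ∷ s) (inj₂ 5) = (A ≺ B) ∷ s
push s _ = s

-- Postfix notation is injective because a stack machine reads the formula back.
evaluate-postfix : ∀ A s → foldl push s (postfix A) ≡ A ∷ s
evaluate-binary : ∀ A B t s →
                  foldl push s (postfix A ++ postfix B ++ [ t ]) ≡ push (B ∷ A ∷ s) t

evaluate-postfix (atom p) s = refl
evaluate-postfix top s = refl
evaluate-postfix bot s = refl
evaluate-postfix (A ∧ B) s = evaluate-binary A B _ s
evaluate-postfix (A ∨ B) s = evaluate-binary A B _ s
evaluate-postfix (A ⊃ B) s = evaluate-binary A B _ s
evaluate-postfix (A ≺ B) s = evaluate-binary A B _ s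

evaluate-binary A B t s = begin
  foldl push s (postfix A ++ postfix B ++ [ t ])
    ≡⟨ Listₚ.foldl-++ push s (postfix A) _ ⟩
  foldl push (foldl push s (postfix A)) (postfix B ++ [ t ])
    ≡⟨ cong (λ s′ → foldl push s′ (postfix B ++ [ t ])) (evaluate-postfix A s) ⟩
  foldl push (A ∷ s) (postfix B ++ [ t ])
    ≡⟨ Listₚ.foldl-++ push (A ∷ s) (postfix B) [ t ] ⟩
  push (foldl push (A ∷ s) (postfix B)) t
    ≡⟨ cong (λ s′ → push s′ t) (evaluate-postfix B (A ∷ s)) ⟩
  push (B ∷ A ∷ s) t ∎
  where open ≡-Reasoning

postfix-injective : ∀ {A B} → postfix A ≡ postfix B → A ≡ B
postfix-injective {A} {B} eq = Listₚ.∷-injectiveˡ (begin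
  A ∷ [] ≡⟨ sym (evaluate-postfix A []) ⟩
  foldl push [] (postfix A) ≡⟨ cong (foldl push []) eq ⟩
  foldl push [] (postfix B) ≡⟨ evaluate-postfix B [] ⟩
  B ∷ [] ∎)
  where open ≡-Reasoning

infix 4 _≟_
_≟_ : DecidableEquality Fml
A ≟ B = map′ postfix-injective (cong postfix)
  (Listₚ.≡-dec (Sumₚ.≡-dec ℕ._≟_ ℕ._≟_) (postfix A) (postfix B))

open import Data.List.Membership.DecPropositional _≟_ using (_∈?_)

-- Subformulas and analytic formulas

⊑-trans : ∀ {A B C} → A ⊑ B → B ⊑ C → A ⊑ C
⊑-trans p ⊑-refl = p
⊑-trans p (⊑-∧l q) = ⊑-∧l (⊑-trans p q)
⊑-trans p (⊑-∧r q) = ⊑-∧r (⊑-trans p q)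
⊑-trans p (⊑-∨l q) = ⊑-∨l (⊑-trans p q)
⊑-trans p (⊑-∨r q) = ⊑-∨r (⊑-trans p q)
⊑-trans p (⊑-⊃l q) = ⊑-⊃l (⊑-trans p q)
⊑-trans p (⊑-⊃r q) = ⊑-⊃r (⊑-trans p q)
⊑-trans p (⊑-≺l q) = ⊑-≺l (⊑-trans p q)
⊑-trans p (⊑-≺r q) = ⊑-≺r (⊑-trans p q)

subformulas properSubformulas : Fml → List Fml
subformulas A = A ∷ properSubformulas A

properSubformulas (atom p) = []
properSubformulas top = []
properSubformulas bot = []
properSubformulas (A ∧ B) = subformulas A ++ subformulas B
properSubformulas (A ∨ B) = subformulas A ++ subformulas B
properSubformulas (A ⊃ B) = subformulas A ++ subformulas B
properSubformulas (A ≺ B) = subformulas A ++ subformulas B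

∈-subformulas⁺ : ∀ {A B} → A ⊑ B → A ∈ subformulas B
∈-subformulas⁺ ⊑-refl = here refl
∈-subformulas⁺ (⊑-∧l p) = there (∈-++⁺ˡ (∈-subformulas⁺ p))
∈-subformulas⁺ {B = B ∧ C} (⊑-∧r p) = there (∈-++⁺ʳ (subformulas B) (∈-subformulas⁺ p))
∈-subformulas⁺ (⊑-∨l p) = there (∈-++⁺ˡ (∈-subformulas⁺ p))
∈-subformulas⁺ {B = B ∨ C} (⊑-∨r p) = there (∈-++⁺ʳ (subformulas B) (∈-subformulas⁺ p))
∈-subformulas⁺ (⊑-⊃l p) = there (∈-++⁺ˡ (∈-subformulas⁺ p))
∈-subformulas⁺ {B = B ⊃ C} (⊑-⊃r p) = there (∈-++⁺ʳ (subformulas B) (∈-subformulas⁺ p))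
∈-subformulas⁺ (⊑-≺l p) = there (∈-++⁺ˡ (∈-subformulas⁺ p))
∈-subformulas⁺ {B = B ≺ C} (⊑-≺r p) = there (∈-++⁺ʳ (subformulas B) (∈-subformulas⁺ p))

∈-subformulas⁻ : ∀ B {A} → A ∈ subformulas B → A ⊑ B
∈-subformulas⁻ B (here refl) = ⊑-refl
∈-subformulas⁻ (B ∧ C) (there m) with ∈-++⁻ (subformulas B) m
... | inj₁ m′ = ⊑-∧l (∈-subformulas⁻ B m′)
... | inj₂ m′ = ⊑-∧r (∈-subformulas⁻ C m′)
∈-subformulas⁻ (B ∨ C) (there m) with ∈-++⁻ (subformulas B) m
... | inj₁ m′ = ⊑-∨l (∈-subformulas⁻ B m′)
... | inj₂ m′ = ⊑-∨r (∈-subformulas⁻ C m′)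
∈-subformulas⁻ (B ⊃ C) (there m) with ∈-++⁻ (subformulas B) m
... | inj₁ m′ = ⊑-⊃l (∈-subformulas⁻ B m′)
... | inj₂ m′ = ⊑-⊃r (∈-subformulas⁻ C m′)
∈-subformulas⁻ (B ≺ C) (there m) with ∈-++⁻ (subformulas B) m
... | inj₁ m′ = ⊑-≺l (∈-subformulas⁻ B m′)
... | inj₂ m′ = ⊑-≺r (∈-subformulas⁻ C m′)

infix 4 _⊑?_
_⊑?_ : ∀ A B → Dec (A ⊑ B)
A ⊑? B = map′ (∈-subformulas⁻ B) ∈-subformulas⁺ (A ∈? subformulas B)

subformulasOf : Ctx → List Fml
subformulasOf [] = []
subformulasOf (C ∷ Γ) = subformulas C ++ subformulasOf Γ

∈-subformulasOf⁺ : ∀ {A C Γ} → C ∈ Γ → A ⊑ C → A ∈ subformulasOf Γ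
∈-subformulasOf⁺ (here refl) A⊑C = ∈-++⁺ˡ (∈-subformulas⁺ A⊑C)
∈-subformulasOf⁺ {Γ = D ∷ Γ} (there m) A⊑C = ∈-++⁺ʳ (subformulas D) (∈-subformulasOf⁺ m A⊑C)

∈-subformulasOf⁻ : ∀ Γ {A} → A ∈ subformulasOf Γ → ∃ λ C → C ∈ Γ × A ⊑ C
∈-subformulasOf⁻ (C ∷ Γ) m with ∈-++⁻ (subformulas C) m
... | inj₁ m′ = C , here refl , ∈-subformulas⁻ C m′
... | inj₂ m′ with ∈-subformulasOf⁻ Γ m′
...   | D , D∈Γ , A⊑D = D , there D∈Γ , A⊑D

subformulasOf-closed : ∀ Γ {A B} → A ⊑ B → B ∈ subformulasOf Γ → A ∈ subformulasOf Γ
subformulasOf-closed Γ A⊑B B∈ with ∈-subformulasOf⁻ Γ B∈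
... | C , C∈Γ , B⊑C = ∈-subformulasOf⁺ C∈Γ (⊑-trans A⊑B B⊑C)

⊆-subformulasOf : ∀ {Γ} → Γ ⊆ subformulasOf Γ
⊆-subformulasOf C∈Γ = ∈-subformulasOf⁺ C∈Γ ⊑-refl

analytic? : ∀ Γ Δ A → Dec (analytic Γ Δ A)
analytic? Γ Δ A = map′ witness lose′ (any? (A ⊑?_) Γ ⊎-dec any? (A ⊑?_) Δ)
  where
  witness : Any (A ⊑_) Γ ⊎ Any (A ⊑_) Δ → analytic Γ Δ A
  witness (inj₁ a) = let C , m , s = find a in C , inj₁ m , s
  witness (inj₂ a) = let C , m , s = find a in C , inj₂ m , s
  lose′ : analytic Γ Δ A → Any (A ⊑_) Γ ⊎ Any (A ⊑_) Δ
  lose′ (C , inj₁ m , s) = inj₁ (lose m s)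
  lose′ (C , inj₂ m , s) = inj₂ (lose m s)

Sequent : Set
Sequent = Ctx × Ctx

Analytic : Sequent → Fml → Set
Analytic (Γ , Δ) = analytic Γ Δ

Below : Sequent → Sequent → Set
Below (Γ , Δ) s = ∀ {A} → A ∈ Γ ⊎ A ∈ Δ → Analytic s A

analytic-trans : ∀ {Γ Δ s A} → Below (Γ , Δ) s → analytic Γ Δ A → Analytic s A
analytic-trans below (C , C∈ , A⊑C) with below C∈
... | D , D∈ , C⊑D = D , D∈ , ⊑-trans A⊑C C⊑D

⊆-Below : ∀ {Γ Δ Γ′ Δ′} → Γ ⊆ Γ′ → Δ ⊆ Δ′ → Below (Γ , Δ) (Γ′ , Δ′)
⊆-Below Γ⊆ Δ⊆ (inj₁ m) = _ , inj₁ (Γ⊆ m) , ⊑-refl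
⊆-Below Γ⊆ Δ⊆ (inj₂ m) = _ , inj₂ (Δ⊆ m) , ⊑-refl

Below-⊆ : ∀ {Γ Δ Γ′ Δ′ s} → Γ′ ⊆ Γ → Δ′ ⊆ Δ → Below (Γ , Δ) s → Below (Γ′ , Δ′) s
Below-⊆ Γ′⊆ Δ′⊆ below (inj₁ m) = below (inj₁ (Γ′⊆ m))
Below-⊆ Γ′⊆ Δ′⊆ below (inj₂ m) = below (inj₂ (Δ′⊆ m))

Below-∷ˡ : ∀ {Γ Δ s A} → Below (Γ , Δ) s → Analytic s A → Below (A ∷ Γ , Δ) s
Below-∷ˡ below an (inj₁ (here refl)) = an
Below-∷ˡ below an (inj₁ (there m)) = below (inj₁ m)
Below-∷ˡ below an (inj₂ m) = below (inj₂ m)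

Below-∷ʳ : ∀ {Γ Δ s A} → Below (Γ , Δ) s → Analytic s A → Below (Γ , A ∷ Δ) s
Below-∷ʳ below an (inj₁ m) = below (inj₁ m)
Below-∷ʳ below an (inj₂ (here refl)) = an
Below-∷ʳ below an (inj₂ (there m)) = below (inj₂ m)

-- Admissible structural rules and basic sequents

module _ {K : CutCond} where

  identity : ∀ A {Γ Δ} → Proof K (A ∷ Γ) (A ∷ Δ)
  identity (atom p) = init p
  identity top = topR
  identity bot = botL
  identity (A ∧ B) = ∧L (∧R (identity A) (exch (swap _ _ refl) refl (identity B)))
  identity (A ∨ B) = ∨L (∨R (identity A)) (∨R (exch refl (swap _ _ refl) (identity B)))
  identity (A ⊃ B) =
    ⊃R (exch (swap _ _ refl) refl (⊃L (exch (swap _ _ refl) refl (identity A)) (identity B)))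
  identity (A ≺ B) =
    ≺L (exch refl (swap _ _ refl) (≺R (identity A) (exch refl (swap _ _ refl) (identity B))))

  weakenˡ : ∀ Γ′ {Γ Δ} → Proof K Γ Δ → Proof K (Γ′ ++ Γ) Δ
  weakenˡ [] p = p
  weakenˡ (A ∷ Γ′) p = wL A (weakenˡ Γ′ p)

  weakenʳ : ∀ Δ′ {Γ Δ} → Proof K Γ Δ → Proof K Γ (Δ′ ++ Δ)
  weakenʳ [] p = p
  weakenʳ (A ∷ Δ′) p = wR A (weakenʳ Δ′ p)

  ∈-contractˡ : ∀ {A Γ Δ} → A ∈ Γ → Proof K (A ∷ Γ) Δ → Proof K Γ Δ
  ∈-contractˡ {A} m p with ∈-∃++ m
  ... | Γ₁ , Γ₂ , refl =
    exch (↭-sym (shift A Γ₁ Γ₂)) refl (cL A (exch (prep A (shift A Γ₁ Γ₂)) refl p))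

  ∈-contractʳ : ∀ {A Γ Δ} → A ∈ Δ → Proof K Γ (A ∷ Δ) → Proof K Γ Δ
  ∈-contractʳ {A} m p with ∈-∃++ m
  ... | Δ₁ , Δ₂ , refl =
    exch refl (↭-sym (shift A Δ₁ Δ₂)) (cR A (exch refl (prep A (shift A Δ₁ Δ₂)) p))

  contractˡ : ∀ Γ′ {Γ Δ} → Γ′ ⊆ Γ → Proof K (Γ′ ++ Γ) Δ → Proof K Γ Δ
  contractˡ [] _ p = p
  contractˡ (A ∷ Γ′) sub p =
    contractˡ Γ′ (sub ∘ there) (∈-contractˡ (∈-++⁺ʳ Γ′ (sub (here refl))) p)

  contractʳ : ∀ Δ′ {Γ Δ} → Δ′ ⊆ Δ → Proof K Γ (Δ′ ++ Δ) → Proof K Γ Δ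
  contractʳ [] _ p = p
  contractʳ (A ∷ Δ′) sub p =
    contractʳ Δ′ (sub ∘ there) (∈-contractʳ (∈-++⁺ʳ Δ′ (sub (here refl))) p)

  mono : ∀ {Γ Δ Γ′ Δ′} → Γ ⊆ Γ′ → Δ ⊆ Δ′ → Proof K Γ Δ → Proof K Γ′ Δ′
  mono {Γ} {Δ} {Γ′} {Δ′} Γ⊆Γ′ Δ⊆Δ′ p = contractʳ Δ Δ⊆Δ′ (contractˡ Γ Γ⊆Γ′
    (exch (++-comm Γ′ Γ) (++-comm Δ′ Δ) (weakenʳ Δ′ (weakenˡ Γ′ p))))

  mono-All : ∀ {Σ Π Γ Δ} → All (_∈ Γ) Σ → All (_∈ Δ) Π → Proof K Σ Π → Proof K Γ Δ
  mono-All σ π = mono (All.lookup σ) (All.lookup π)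

-- Γ ⇒ Δ contains an identity, or a sequent derived from identities by one logical rule.
data Basic (Γ Δ : Ctx) : Set where
  shared   : ∀ {A} → A ∈ Γ → A ∈ Δ → Basic Γ Δ
  ⊤-right  : top ∈ Δ → Basic Γ Δ
  ⊥-left   : bot ∈ Γ → Basic Γ Δ
  ∧-left₁  : ∀ {A B} → A ∧ B ∈ Γ → A ∈ Δ → Basic Γ Δ
  ∧-left₂  : ∀ {A B} → A ∧ B ∈ Γ → B ∈ Δ → Basic Γ Δ
  ∧-right  : ∀ {A B} → A ∈ Γ → B ∈ Γ → A ∧ B ∈ Δ → Basic Γ Δ
  ∨-left   : ∀ {A B} → A ∨ B ∈ Γ → A ∈ Δ → B ∈ Δ → Basic Γ Δ
  ∨-right₁ : ∀ {A B} → A ∈ Γ → A ∨ B ∈ Δ → Basic Γ Δ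
  ∨-right₂ : ∀ {A B} → B ∈ Γ → A ∨ B ∈ Δ → Basic Γ Δ
  ⊃-left   : ∀ {A B} → (A ⊃ B) ∈ Γ → A ∈ Γ → B ∈ Δ → Basic Γ Δ
  ≺-right  : ∀ {A B} → A ∈ Γ → (A ≺ B) ∈ Δ → B ∈ Δ → Basic Γ Δ

basic-provable : ∀ {K Γ Δ} → Basic Γ Δ → Proof K Γ Δ
basic-provable (shared a b) = mono-All (a ∷ []) (b ∷ []) (identity _)
basic-provable (⊤-right t) = mono-All [] (t ∷ []) topR
basic-provable (⊥-left b) = mono-All (b ∷ []) [] botL
basic-provable (∧-left₁ c a) = mono-All (c ∷ []) (a ∷ []) (∧L (identity _))
basic-provable (∧-left₂ c b) = mono-All (c ∷ []) (b ∷ []) (∧L (exch (swap _ _ refl) refl (identity _)))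
basic-provable (∧-right a b c) =
  mono-All (a ∷ b ∷ []) (c ∷ []) (∧R (identity _) (exch (swap _ _ refl) refl (identity _)))
basic-provable (∨-left c a b) =
  mono-All (c ∷ []) (a ∷ b ∷ []) (∨L (identity _) (exch refl (swap _ _ refl) (identity _)))
basic-provable (∨-right₁ a c) = mono-All (a ∷ []) (c ∷ []) (∨R (identity _))
basic-provable (∨-right₂ b c) = mono-All (b ∷ []) (c ∷ []) (∨R (exch refl (swap _ _ refl) (identity _)))
basic-provable (⊃-left c a b) =
  mono-All (c ∷ a ∷ []) (b ∷ []) (⊃L (exch (swap _ _ refl) refl (identity _)) (identity _))
basic-provable (≺-right a c b) =
  mono-All (a ∷ []) (c ∷ b ∷ []) (≺R (identity _) (exch refl (swap _ _ refl) (identity _)))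

Within : Ctx → Ctx → Sequent → Set
Within Γ Δ (Σ , Π) = All (_∈ Γ) Σ × All (_∈ Δ) Π

basicSequents : Fml → List Sequent
basicSequents C = ([ C ] , [ C ]) ∷ principal C
  where
  principal : Fml → List Sequent
  principal (atom p) = []
  principal top = ([] , [ top ]) ∷ []
  principal bot = ([ bot ] , []) ∷ []
  principal (A ∧ B) =
    ([ A ∧ B ] , [ A ]) ∷ ([ A ∧ B ] , [ B ]) ∷ (A ∷ B ∷ [] , [ A ∧ B ]) ∷ []
  principal (A ∨ B) =
    ([ A ∨ B ] , A ∷ B ∷ []) ∷ ([ A ] , [ A ∨ B ]) ∷ ([ B ] , [ A ∨ B ]) ∷ []
  principal (A ⊃ B) = ((A ⊃ B) ∷ A ∷ [] , [ B ]) ∷ []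
  principal (A ≺ B) = ([ A ] , (A ≺ B) ∷ B ∷ []) ∷ []

module _ {Γ Δ : Ctx} where

  within-basic : ∀ C {s} → s ∈ basicSequents C → Within Γ Δ s → Basic Γ Δ
  within-basic C (here refl) (a ∷ [] , b ∷ []) = shared a b
  within-basic top (there (here refl)) ([] , t ∷ []) = ⊤-right t
  within-basic bot (there (here refl)) (b ∷ [] , []) = ⊥-left b
  within-basic (A ∧ B) (there (here refl)) (c ∷ [] , a ∷ []) = ∧-left₁ c a
  within-basic (A ∧ B) (there (there (here refl))) (c ∷ [] , b ∷ []) = ∧-left₂ c b
  within-basic (A ∧ B) (there (there (there (here refl)))) (a ∷ b ∷ [] , c ∷ []) = ∧-right a b c
  within-basic (A ∨ B) (there (here refl)) (c ∷ [] , a ∷ b ∷ []) = ∨-left c a b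
  within-basic (A ∨ B) (there (there (here refl))) (a ∷ [] , c ∷ []) = ∨-right₁ a c
  within-basic (A ∨ B) (there (there (there (here refl)))) (b ∷ [] , c ∷ []) = ∨-right₂ b c
  within-basic (A ⊃ B) (there (here refl)) (c ∷ a ∷ [] , b ∷ []) = ⊃-left c a b
  within-basic (A ≺ B) (there (here refl)) (a ∷ [] , c ∷ b ∷ []) = ≺-right a c b

  BasicCandidate : Set
  BasicCandidate = Any (λ C → Any (Within Γ Δ) (basicSequents C)) (Γ ++ Δ)

  candidate : ∀ {C s} → C ∈ Γ ++ Δ → s ∈ basicSequents C → Within Γ Δ s → BasicCandidate
  candidate C∈ s∈ within = lose C∈ (lose s∈ within)

  basic-candidate : Basic Γ Δ → BasicCandidate
  basic-candidate (shared a b) = candidate (∈-++⁺ˡ a) (here refl) (a ∷ [] , b ∷ [])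
  basic-candidate (⊤-right t) = candidate (∈-++⁺ʳ Γ t) (there (here refl)) ([] , t ∷ [])
  basic-candidate (⊥-left b) = candidate (∈-++⁺ˡ b) (there (here refl)) (b ∷ [] , [])
  basic-candidate (∧-left₁ c a) = candidate (∈-++⁺ˡ c) (there (here refl)) (c ∷ [] , a ∷ [])
  basic-candidate (∧-left₂ c b) =
    candidate (∈-++⁺ˡ c) (there (there (here refl))) (c ∷ [] , b ∷ [])
  basic-candidate (∧-right a b c) =
    candidate (∈-++⁺ʳ Γ c) (there (there (there (here refl)))) (a ∷ b ∷ [] , c ∷ [])
  basic-candidate (∨-left c a b) = candidate (∈-++⁺ˡ c) (there (here refl)) (c ∷ [] , a ∷ b ∷ [])
  basic-candidate (∨-right₁ a c) =
    candidate (∈-++⁺ʳ Γ c) (there (there (here refl))) (a ∷ [] , c ∷ [])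
  basic-candidate (∨-right₂ b c) =
    candidate (∈-++⁺ʳ Γ c) (there (there (there (here refl)))) (b ∷ [] , c ∷ [])
  basic-candidate (⊃-left c a b) = candidate (∈-++⁺ˡ c) (there (here refl)) (c ∷ a ∷ [] , b ∷ [])
  basic-candidate (≺-right a c b) = candidate (∈-++⁺ʳ Γ c) (there (here refl)) (a ∷ [] , c ∷ b ∷ [])

  candidate-basic : BasicCandidate → Basic Γ Δ
  candidate-basic c with find c
  ... | C , _ , s with find s
  ...   | _ , s∈ , within = within-basic C s∈ within

  basic? : Dec (Basic Γ Δ)
  basic? = map′ candidate-basic basic-candidate
    (any? (λ C → any? within? (basicSequents C)) (Γ ++ Δ))
    where
    within? : ∀ s → Dec (Within Γ Δ s)
    within? (Σ , Π) = all? (_∈? Γ) Σ ×-dec all? (_∈? Δ) Π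

-- Kripke semantics

record Kripke : Set₁ where
  field
    World : Set
    _≤_ : World → World → Set
    ≤-refl : ∀ {w} → w ≤ w
    ≤-trans : ∀ {u v w} → u ≤ v → v ≤ w → u ≤ w
    Val : World → ℕ → Set
    Val-mono : ∀ {w w′ p} → w ≤ w′ → Val w p → Val w′ p

module Forcing (M : Kripke) where
  open Kripke M

  -- Implication is forced up to double negation: classically the usual clause, and exactly
  -- what the constructive soundness argument for ⊃R can deliver.
  infix 3 _⊩_
  _⊩_ : World → Fml → Set
  w ⊩ atom p = Val w p
  w ⊩ top = ⊤
  w ⊩ bot = ⊥
  w ⊩ A ∧ B = w ⊩ A × w ⊩ B
  w ⊩ A ∨ B = w ⊩ A ⊎ w ⊩ B
  w ⊩ A ⊃ B = ∀ {w′} → w ≤ w′ → w′ ⊩ A → ¬ ¬ (w′ ⊩ B)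
  w ⊩ A ≺ B = ∃ λ w′ → w′ ≤ w × w′ ⊩ A × ¬ (w′ ⊩ B)

  persistent : ∀ A {w w′} → w ≤ w′ → w ⊩ A → w′ ⊩ A
  persistent (atom p) w≤w′ = Val-mono w≤w′
  persistent top w≤w′ _ = tt
  persistent (A ∧ B) w≤w′ (a , b) = persistent A w≤w′ a , persistent B w≤w′ b
  persistent (A ∨ B) w≤w′ (inj₁ a) = inj₁ (persistent A w≤w′ a)
  persistent (A ∨ B) w≤w′ (inj₂ b) = inj₂ (persistent B w≤w′ b)
  persistent (A ⊃ B) w≤w′ f w′≤w″ = f (≤-trans w≤w′ w′≤w″)
  persistent (A ≺ B) w≤w′ (v , v≤w , a , ¬b) = v , ≤-trans v≤w w≤w′ , a , ¬b

  Refutes : World → Ctx → Ctx → Set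
  Refutes w Γ Δ = All (w ⊩_) Γ × All (λ C → ¬ (w ⊩ C)) Δ

  sound : ∀ {K Γ Δ} → Proof K Γ Δ → ∀ {w} → Refutes w Γ Δ → ⊥
  sound (exch Γ↭ Δ↭ p) (γ , δ) = sound p (All-resp-↭ (↭-sym Γ↭) γ , All-resp-↭ (↭-sym Δ↭) δ)
  sound (init p) (a ∷ _ , ¬a ∷ _) = ¬a a
  sound (cut A _ p q) (γ , δ) = sound p (γ , (λ a → sound q (a ∷ γ , δ)) ∷ δ)
  sound (wL A p) (_ ∷ γ , δ) = sound p (γ , δ)
  sound (wR A p) (γ , _ ∷ δ) = sound p (γ , δ)
  sound (cL A p) (a ∷ γ , δ) = sound p (a ∷ a ∷ γ , δ)
  sound (cR A p) (γ , ¬a ∷ δ) = sound p (γ , ¬a ∷ ¬a ∷ δ)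
  sound (topL p) (_ ∷ γ , δ) = sound p (γ , δ)
  sound topR (γ , ¬⊤ ∷ δ) = ¬⊤ tt
  sound botL (() ∷ γ , δ)
  sound (botR p) (γ , _ ∷ δ) = sound p (γ , δ)
  sound (∧L p) ((a , b) ∷ γ , δ) = sound p (a ∷ b ∷ γ , δ)
  sound (∧R p q) (γ , ¬ab ∷ δ) =
    sound p (γ , (λ a → sound q (γ , (λ b → ¬ab (a , b)) ∷ δ)) ∷ δ)
  sound (∨L p q) (inj₁ a ∷ γ , δ) = sound p (a ∷ γ , δ)
  sound (∨L p q) (inj₂ b ∷ γ , δ) = sound q (b ∷ γ , δ)
  sound (∨R p) (γ , ¬ab ∷ δ) = sound p (γ , (¬ab ∘ inj₁) ∷ (¬ab ∘ inj₂) ∷ δ)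
  sound (⊃L p q) (f ∷ γ , δ) =
    sound p (f ∷ γ , (λ a → f ≤-refl a (λ b → sound q (b ∷ f ∷ γ , δ))) ∷ δ)
  sound (⊃R p) (γ , ¬f ∷ δ) =
    ¬f (λ w≤w′ a ¬b → sound p (a ∷ All.map (λ {A} → persistent A w≤w′) γ , ¬b ∷ []))
  sound (≺L p) ((w′ , w′≤w , a , ¬b) ∷ γ , δ) =
    sound p (a ∷ [] , ¬b ∷ All.map (λ {C} ¬c → ¬c ∘ persistent C w′≤w) δ)
  sound (≺R p q) {w} (γ , ¬d ∷ δ) =
    sound p (γ , (λ a → ¬d (w , ≤-refl , a , λ b → sound q (b ∷ γ , ¬d ∷ δ))) ∷ ¬d ∷ δ)

_⊨_ : Ctx → Ctx → Set₁
Γ ⊨ Δ = ∀ (M : Kripke) {w : Kripke.World M} → Forcing.Refutes M w Γ Δ → ⊥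

soundness : ∀ {K Γ Δ} → Proof K Γ Δ → Γ ⊨ Δ
soundness p M = Forcing.sound M p

-- Saturating a finite set under decidable rules

module Saturation {A : Set} (_≟ᵉ_ : DecidableEquality A)
                  (elements : List A) (∈-elements : ∀ a → a ∈ elements)
                  (Good : A → Set)
                  (Rule : (A → Bool) → A → Set)
                  (rule? : ∀ marked a → Dec (Rule marked a))
                  (rule-sound : ∀ {marked} → (∀ a → marked a ≡ true → Good a) →
                                ∀ {a} → Rule marked a → Good a)
                  where

  Sound Closed : (A → Bool) → Set
  Sound marked = ∀ a → marked a ≡ true → Good a
  Closed marked = ∀ a → marked a ≡ false → ¬ Rule marked a

  unmarked : (A → Bool) → List A → ℕ
  unmarked marked [] = 0
  unmarked marked (a ∷ as) = if marked a then unmarked marked as else suc (unmarked marked as)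

  module _ {marked marked′ : A → Bool} (grows : ∀ a → marked a ≡ true → marked′ a ≡ true) where

    unmarked-anti : ∀ as → unmarked marked′ as ℕ.≤ unmarked marked as
    unmarked-anti [] = z≤n
    unmarked-anti (a ∷ as) with marked a in old | marked′ a in new
    ... | true | true = unmarked-anti as
    ... | true | false = contradiction (trans (sym (grows a old)) new) λ ()
    ... | false | true = m≤n⇒m≤1+n (unmarked-anti as)
    ... | false | false = s≤s (unmarked-anti as)

    unmarked-strict : ∀ {as p} → p ∈ as → marked p ≡ false → marked′ p ≡ true →
                      unmarked marked′ as ℕ.< unmarked marked as
    unmarked-strict {p ∷ as} (here refl) old new rewrite old | new = s≤s (unmarked-anti as)
    unmarked-strict {a ∷ as} (there p∈) old new with marked a in old′ | marked′ a in new′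
    ... | true | true = unmarked-strict p∈ old new
    ... | true | false = contradiction (trans (sym (grows a old′)) new′) λ ()
    ... | false | true = m≤n⇒m≤1+n (unmarked-strict p∈ old new)
    ... | false | false = s≤s (unmarked-strict p∈ old new)

  mark : (A → Bool) → A → A → Bool
  mark marked p a = does (a ≟ᵉ p) Bool.∨ marked a

  mark-grows : ∀ marked p a → marked a ≡ true → mark marked p a ≡ true
  mark-grows marked p a marked-a with a ≟ᵉ p
  ... | yes _ = refl
  ... | no _ = marked-a

  mark-sound : ∀ {marked p} → Sound marked → Rule marked p → Sound (mark marked p)
  mark-sound {p = p} sound r a marked-a with a ≟ᵉ p
  ... | yes refl = rule-sound sound r
  ... | no _ = sound a marked-a

  Saturated : Set
  Saturated = Σ (A → Bool) λ marked → Sound marked × Closed marked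

  iterate : ∀ marked → Acc ℕ._<_ (unmarked marked elements) → Sound marked → Saturated
  iterate marked (acc more) sound
    with any? (λ a → (marked a Bool.≟ false) ×-dec rule? marked a) elements
  ... | no none = marked , sound , λ a unmarked-a r → none (lose (∈-elements a) (unmarked-a , r))
  ... | yes some with find some
  ...   | p , p∈ , unmarked-p , r = iterate (mark marked p) (more progress) (mark-sound sound r)
    where
    progress : unmarked (mark marked p) elements ℕ.< unmarked marked elements
    progress = unmarked-strict (mark-grows marked p) p∈ unmarked-p
                 (cong (Bool._∨ marked p) (dec-true (p ≟ᵉ p) refl))

  saturate : Saturated
  saturate = iterate (λ _ → false) (<-wellFounded _) (λ _ ())

subsets : ∀ n → List (Subset n)
subsets zero = [ [] ]
subsets (suc n) = map (inside ∷_) (subsets n) ++ map (outside ∷_) (subsets n)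

∈-subsets : ∀ {n} (p : Subset n) → p ∈ subsets n
∈-subsets [] = here refl
∈-subsets (inside ∷ p) = ∈-++⁺ˡ (∈-map⁺ (inside ∷_) (∈-subsets p))
∈-subsets {suc n} (outside ∷ p) =
  ∈-++⁺ʳ (map (inside ∷_) (subsets n)) (∈-map⁺ (outside ∷_) (∈-subsets p))

module _ {A : Set} where

  select : (xs : List A) → Subset (length xs) → List A
  select [] [] = []
  select (x ∷ xs) (inside ∷ p) = x ∷ select xs p
  select (x ∷ xs) (outside ∷ p) = select xs p

  ∈-select⁺ : ∀ xs {p i} → i ∈ₛ p → lookup xs i ∈ select xs p
  ∈-select⁺ (x ∷ xs) Vec.here = here refl
  ∈-select⁺ (x ∷ xs) {inside ∷ p} (Vec.there i∈p) = there (∈-select⁺ xs i∈p)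
  ∈-select⁺ (x ∷ xs) {outside ∷ p} (Vec.there i∈p) = ∈-select⁺ xs i∈p

  ∈-select⁻ : ∀ xs {p a} → a ∈ select xs p → ∃ λ i → i ∈ₛ p × lookup xs i ≡ a
  ∈-select⁻ [] {[]} ()
  ∈-select⁻ (x ∷ xs) {inside ∷ p} (here refl) = zero , Vec.here , refl
  ∈-select⁻ (x ∷ xs) {inside ∷ p} (there m) =
    let i , i∈p , eq = ∈-select⁻ xs m in suc i , Vec.there i∈p , eq
  ∈-select⁻ (x ∷ xs) {outside ∷ p} m =
    let i , i∈p , eq = ∈-select⁻ xs m in suc i , Vec.there i∈p , eq

  select-⊆ : ∀ xs {p} → select xs p ⊆ xs
  select-⊆ xs m with ∈-select⁻ xs m
  ... | i , _ , refl = ∈-lookup i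

  select-mono : ∀ xs {p q} → p ⊆ₛ q → select xs p ⊆ select xs q
  select-mono xs p⊆q m with ∈-select⁻ xs m
  ... | i , i∈p , refl = ∈-select⁺ xs (p⊆q i∈p)

  select-∪⁅⁆ : ∀ xs {p i} → select xs (p ∪ ⁅ i ⁆) ⊆ lookup xs i ∷ select xs p
  select-∪⁅⁆ xs {p} {i} m with ∈-select⁻ xs m
  ... | j , j∈ , refl with x∈p∪q⁻ p ⁅ i ⁆ j∈
  ...   | inj₁ j∈p = there (∈-select⁺ xs j∈p)
  ...   | inj₂ j∈⁅i⁆ = here (cong (lookup xs) (x∈⁅y⁆⇒x≡y i j∈⁅i⁆))

  select-⁅⁆ : ∀ xs {i} → select xs ⁅ i ⁆ ⊆ [ lookup xs i ]
  select-⁅⁆ xs {i} m with ∈-select⁻ xs m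
  ... | j , j∈ , refl = here (cong (lookup xs) (x∈⁅y⁆⇒x≡y i j∈))

-- The canonical model over a subformula-closed list of formulas

module Canonical (U : Ctx) (U-closed : ∀ {A B} → A ⊑ B → B ∈ U → A ∈ U) where

  Index : Set
  Index = Fin (length U)

  formula : Index → Fml
  formula = lookup U

  locate : ∀ {A} → A ∈ U → ∃ λ i → formula i ≡ A
  locate m = Any.index m , sym (lookup-index m)

  ⟦_⟧ : Subset (length U) → Ctx
  ⟦_⟧ = select U

  analytic-∈ : ∀ {X Y A} → analytic ⟦ X ⟧ ⟦ Y ⟧ A → A ∈ U
  analytic-∈ (C , inj₁ m , A⊑C) = U-closed A⊑C (select-⊆ U m)
  analytic-∈ (C , inj₂ m , A⊑C) = U-closed A⊑C (select-⊆ U m)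

  Pair : Set
  Pair = Subset (length U) × Subset (length U)

  Provable : Pair → Set
  Provable (X , Y) = LocallyAnalyticProof ⟦ X ⟧ ⟦ Y ⟧

  -- No further logical rules are needed: a world decides all analytic formulas, and Basic
  -- sequents then rule out every configuration that the other rules would derive.
  data Rule (marked : Pair → Bool) : Pair → Set where
    basic : ∀ {X Y} → Basic ⟦ X ⟧ ⟦ Y ⟧ → Rule marked (X , Y)
    ⊃-right : ∀ {X Y} a b → (formula a ⊃ formula b) ∈ ⟦ Y ⟧ →
              marked (X ∪ ⁅ a ⁆ , ⁅ b ⁆) ≡ true → Rule marked (X , Y)
    ≺-left : ∀ {X Y} a b → (formula a ≺ formula b) ∈ ⟦ X ⟧ →
             marked (⁅ a ⁆ , Y ∪ ⁅ b ⁆) ≡ true → Rule marked (X , Y)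
    analytic-cut : ∀ {X Y} i → analytic ⟦ X ⟧ ⟦ Y ⟧ (formula i) →
                   marked (X ∪ ⁅ i ⁆ , Y) ≡ true → marked (X , Y ∪ ⁅ i ⁆) ≡ true →
                   Rule marked (X , Y)

  rule-sound : ∀ {marked} → (∀ p → marked p ≡ true → Provable p) →
               ∀ {p} → Rule marked p → Provable p
  rule-sound provable (basic b) = basic-provable b
  rule-sound provable (⊃-right a b m marked) =
    ∈-contractʳ m (⊃R (mono (select-∪⁅⁆ U) (select-⁅⁆ U) (provable _ marked)))
  rule-sound provable (≺-left a b m marked) =
    ∈-contractˡ m (≺L (mono (select-⁅⁆ U) (select-∪⁅⁆ U) (provable _ marked)))
  rule-sound provable (analytic-cut i an markedˡ markedʳ) = cut (formula i) an
    (mono ⊆-refl (select-∪⁅⁆ U) (provable _ markedʳ))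
    (mono (select-∪⁅⁆ U) ⊆-refl (provable _ markedˡ))

  rule? : ∀ marked p → Dec (Rule marked p)
  rule? marked (X , Y)
    with basic? {⟦ X ⟧} {⟦ Y ⟧} | Fin.any? ⊃-right? | Fin.any? ≺-left? | Fin.any? cut?
    where
    marked? : ∀ p → Dec (marked p ≡ true)
    marked? p = marked p Bool.≟ true
    ⊃-right? : ∀ a → Dec (∃ λ b → (formula a ⊃ formula b) ∈ ⟦ Y ⟧ ×
                                   marked (X ∪ ⁅ a ⁆ , ⁅ b ⁆) ≡ true)
    ⊃-right? a = Fin.any? λ b →
      ((formula a ⊃ formula b) ∈? ⟦ Y ⟧) ×-dec marked? (X ∪ ⁅ a ⁆ , ⁅ b ⁆)
    ≺-left? : ∀ a → Dec (∃ λ b → (formula a ≺ formula b) ∈ ⟦ X ⟧ ×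
                                  marked (⁅ a ⁆ , Y ∪ ⁅ b ⁆) ≡ true)
    ≺-left? a = Fin.any? λ b →
      ((formula a ≺ formula b) ∈? ⟦ X ⟧) ×-dec marked? (⁅ a ⁆ , Y ∪ ⁅ b ⁆)
    cut? : ∀ i → Dec (analytic ⟦ X ⟧ ⟦ Y ⟧ (formula i) ×
                      marked (X ∪ ⁅ i ⁆ , Y) ≡ true × marked (X , Y ∪ ⁅ i ⁆) ≡ true)
    cut? i = analytic? ⟦ X ⟧ ⟦ Y ⟧ (formula i) ×-dec
             marked? (X ∪ ⁅ i ⁆ , Y) ×-dec marked? (X , Y ∪ ⁅ i ⁆)
  ... | yes b | _ | _ | _ = yes (basic b)
  ... | _ | yes (a , b , m , marked) | _ | _ = yes (⊃-right a b m marked)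
  ... | _ | _ | yes (a , b , m , marked) | _ = yes (≺-left a b m marked)
  ... | _ | _ | _ | yes (i , an , markedˡ , markedʳ) = yes (analytic-cut i an markedˡ markedʳ)
  ... | no ¬b | no ¬⊃ | no ¬≺ | no ¬cut = no λ where
    (basic b) → ¬b b
    (⊃-right a b m marked) → ¬⊃ (a , b , m , marked)
    (≺-left a b m marked) → ¬≺ (a , b , m , marked)
    (analytic-cut i an markedˡ markedʳ) → ¬cut (i , an , markedˡ , markedʳ)

  _≟ₚ_ : DecidableEquality Pair
  _≟ₚ_ = Productₚ.≡-dec (Vecₚ.≡-dec Bool._≟_) (Vecₚ.≡-dec Bool._≟_)

  pairs : List Pair
  pairs = cartesianProduct (subsets _) (subsets _)

  ∈-pairs : ∀ p → p ∈ pairs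
  ∈-pairs (X , Y) = ∈-cartesianProduct⁺ (∈-subsets X) (∈-subsets Y)

  open Saturation _≟ₚ_ pairs ∈-pairs Provable Rule rule? rule-sound using (saturate)

  marked : Pair → Bool
  marked = proj₁ saturate

  marked-provable : ∀ p → marked p ≡ true → Provable p
  marked-provable = proj₁ (proj₂ saturate)

  unmarked-stuck : ∀ p → marked p ≡ false → ¬ Rule marked p
  unmarked-stuck = proj₂ (proj₂ saturate)

  record World : Set where
    field
      X Y : Subset (length U)
      unmarked : marked (X , Y) ≡ false
      saturated : ∀ {A} → analytic ⟦ X ⟧ ⟦ Y ⟧ A → A ∈ ⟦ X ⟧ ⊎ A ∈ ⟦ Y ⟧

  open World

  stuck : ∀ w → ¬ Rule marked (X w , Y w)
  stuck w = unmarked-stuck _ (unmarked w)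

  absurd-basic : ∀ w → ¬ Basic ⟦ X w ⟧ ⟦ Y w ⟧
  absurd-basic w = stuck w ∘ basic

  decides : ∀ w {A C} → C ∈ ⟦ X w ⟧ ⊎ C ∈ ⟦ Y w ⟧ → A ⊑ C → A ∈ ⟦ X w ⟧ ⊎ A ∈ ⟦ Y w ⟧
  decides w C∈ A⊑C = saturated w (_ , C∈ , A⊑C)

  infix 4 _≤_
  _≤_ : World → World → Set
  w ≤ w′ = ⟦ X w ⟧ ⊆ ⟦ X w′ ⟧ × ⟦ Y w′ ⟧ ⊆ ⟦ Y w ⟧

  canonical : Kripke
  canonical = record
    { World = World
    ; _≤_ = _≤_
    ; ≤-refl = ⊆-refl , ⊆-refl
    ; ≤-trans = λ (X⊆ , Y⊇) (X⊆′ , Y⊇′) → X⊆′ ∘ X⊆ , Y⊇ ∘ Y⊇′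
    ; Val = λ w p → atom p ∈ ⟦ X w ⟧
    ; Val-mono = λ w≤w′ → proj₁ w≤w′
    }

  record Partial (X₀ Y₀ : Subset (length U)) : Set where
    constructor partial
    field
      X Y : Subset (length U)
      unmarked : marked (X , Y) ≡ false
      X₀⊆X : X₀ ⊆ₛ X
      Y₀⊆Y : Y₀ ⊆ₛ Y
      below : Below (⟦ X ⟧ , ⟦ Y ⟧) (⟦ X₀ ⟧ , ⟦ Y₀ ⟧)

  Settled : ∀ {X₀ Y₀} → Partial X₀ Y₀ → Index → Set
  Settled e i = i ∈ₛ Partial.X e ⊎ i ∈ₛ Partial.Y e

  settle : ∀ {X₀ Y₀} (e : Partial X₀ Y₀) i → analytic ⟦ X₀ ⟧ ⟦ Y₀ ⟧ (formula i) →
           Σ (Partial X₀ Y₀) λ e′ → (∀ {j} → Settled e j → Settled e′ j) × Settled e′ i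
  settle (partial X Y unm X₀⊆X Y₀⊆Y below) i an with marked (X ∪ ⁅ i ⁆ , Y) in markedˡ
  ... | false =
    partial (X ∪ ⁅ i ⁆) Y markedˡ (p⊆p∪q _ ∘ X₀⊆X) Y₀⊆Y
            (Below-⊆ (select-∪⁅⁆ U) ⊆-refl (Below-∷ˡ below an)) ,
    Sum.map₁ (p⊆p∪q _) , inj₁ (x∈p∪q⁺ (inj₂ (x∈⁅x⁆ i)))
  ... | true with marked (X , Y ∪ ⁅ i ⁆) in markedʳ
  ...   | false =
    partial X (Y ∪ ⁅ i ⁆) markedʳ X₀⊆X (p⊆p∪q _ ∘ Y₀⊆Y)
            (Below-⊆ ⊆-refl (select-∪⁅⁆ U) (Below-∷ʳ below an)) ,
    Sum.map₂ (p⊆p∪q _) , inj₂ (x∈p∪q⁺ (inj₂ (x∈⁅x⁆ i)))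
  ...   | true = ⊥-elim (unmarked-stuck _ unm (analytic-cut i an′ markedˡ markedʳ))
    where
    an′ : analytic ⟦ X ⟧ ⟦ Y ⟧ (formula i)
    an′ = analytic-trans (⊆-Below (select-mono U X₀⊆X) (select-mono U Y₀⊆Y)) an

  settle-all : ∀ is {X₀ Y₀} → Partial X₀ Y₀ →
               Σ (Partial X₀ Y₀) λ e →
                 ∀ {i} → i ∈ is → analytic ⟦ X₀ ⟧ ⟦ Y₀ ⟧ (formula i) → Settled e i
  settle-all [] e = e , λ ()
  settle-all (i ∷ is) {X₀} {Y₀} e with settle-all is e | analytic? ⟦ X₀ ⟧ ⟦ Y₀ ⟧ (formula i)
  ... | e′ , settled | no ¬an = e′ , λ where
    (here refl) an → contradiction an ¬an
    (there m) an → settled m an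
  ... | e′ , settled | yes an with settle e′ i an
  ...   | e″ , grows , settled-i = e″ , λ where
    (here refl) _ → settled-i
    (there m) an′ → grows (settled m an′)

  record Extension (X₀ Y₀ : Subset (length U)) : Set where
    field
      world : World
      X₀⊆ : ⟦ X₀ ⟧ ⊆ ⟦ X world ⟧
      Y₀⊆ : ⟦ Y₀ ⟧ ⊆ ⟦ Y world ⟧
      below : Below (⟦ X world ⟧ , ⟦ Y world ⟧) (⟦ X₀ ⟧ , ⟦ Y₀ ⟧)

  extend : ∀ X₀ Y₀ → marked (X₀ , Y₀) ≡ false → Extension X₀ Y₀
  extend X₀ Y₀ unm with settle-all (allFin _) (partial X₀ Y₀ unm id id (⊆-Below ⊆-refl ⊆-refl))
  ... | partial X Y unm′ X₀⊆X Y₀⊆Y below , settled = record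
    { world = record { X = X ; Y = Y ; unmarked = unm′ ; saturated = decided }
    ; X₀⊆ = select-mono U X₀⊆X
    ; Y₀⊆ = select-mono U Y₀⊆Y
    ; below = below
    }
    where
    decided : ∀ {A} → analytic ⟦ X ⟧ ⟦ Y ⟧ A → A ∈ ⟦ X ⟧ ⊎ A ∈ ⟦ Y ⟧
    decided an with analytic-trans below an
    ... | an₀ with locate (analytic-∈ an₀)
    ...   | i , refl = Sum.map (∈-select⁺ U) (∈-select⁺ U) (settled (∈-allFin i) an₀)

  sequentOf : World → Sequent
  sequentOf w = ⟦ X w ⟧ , ⟦ Y w ⟧

  later : ∀ {w w′} → ⟦ X w ⟧ ⊆ ⟦ X w′ ⟧ → Below (sequentOf w′) (sequentOf w) → w ≤ w′
  later {w} {w′} X⊆X′ below = X⊆X′ , Y′⊆Y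
    where
    Y′⊆Y : ⟦ Y w′ ⟧ ⊆ ⟦ Y w ⟧
    Y′⊆Y A∈Y′ with saturated w (below (inj₂ A∈Y′))
    ... | inj₁ A∈X = ⊥-elim (absurd-basic w′ (shared (X⊆X′ A∈X) A∈Y′))
    ... | inj₂ A∈Y = A∈Y

  earlier : ∀ {w w′} → ⟦ Y w ⟧ ⊆ ⟦ Y w′ ⟧ → Below (sequentOf w′) (sequentOf w) → w′ ≤ w
  earlier {w} {w′} Y⊆Y′ below = X′⊆X , Y⊆Y′
    where
    X′⊆X : ⟦ X w′ ⟧ ⊆ ⟦ X w ⟧
    X′⊆X A∈X′ with saturated w (below (inj₁ A∈X′))
    ... | inj₁ A∈X = A∈X
    ... | inj₂ A∈Y = ⊥-elim (absurd-basic w′ (shared A∈X′ (Y⊆Y′ A∈Y)))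

  ⊃-witness : ∀ {A B} w → (A ⊃ B) ∈ ⟦ Y w ⟧ → ∃ λ w′ → w ≤ w′ × A ∈ ⟦ X w′ ⟧ × B ∈ ⟦ Y w′ ⟧
  ⊃-witness w m with locate (U-closed (⊑-⊃l ⊑-refl) (select-⊆ U m))
                   | locate (U-closed (⊑-⊃r ⊑-refl) (select-⊆ U m))
  ... | a , refl | b , refl with marked (X w ∪ ⁅ a ⁆ , ⁅ b ⁆) in marked-ab
  ...   | true = ⊥-elim (stuck w (⊃-right a b m marked-ab))
  ...   | false =
    world , later {w} {world} (X₀⊆ ∘ select-mono U (p⊆p∪q _)) (analytic-trans below′ ∘ below) ,
    X₀⊆ (∈-select⁺ U (x∈p∪q⁺ (inj₂ (x∈⁅x⁆ a)))) , Y₀⊆ (∈-select⁺ U (x∈⁅x⁆ b))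
    where
    open Extension (extend _ _ marked-ab)
    below′ : Below (⟦ X w ∪ ⁅ a ⁆ ⟧ , ⟦ ⁅ b ⁆ ⟧) (sequentOf w)
    below′ = Below-⊆ (select-∪⁅⁆ U) (select-⁅⁆ U)
               (Below-∷ˡ (Below-∷ʳ (⊆-Below ⊆-refl (λ ())) (_ , inj₂ m , ⊑-⊃r ⊑-refl))
                         (_ , inj₂ m , ⊑-⊃l ⊑-refl))

  ≺-witness : ∀ {A B} w → (A ≺ B) ∈ ⟦ X w ⟧ → ∃ λ w′ → w′ ≤ w × A ∈ ⟦ X w′ ⟧ × B ∈ ⟦ Y w′ ⟧
  ≺-witness w m with locate (U-closed (⊑-≺l ⊑-refl) (select-⊆ U m))
                   | locate (U-closed (⊑-≺r ⊑-refl) (select-⊆ U m))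
  ... | a , refl | b , refl with marked (⁅ a ⁆ , Y w ∪ ⁅ b ⁆) in marked-ab
  ...   | true = ⊥-elim (stuck w (≺-left a b m marked-ab))
  ...   | false =
    world , earlier {w} {world} (Y₀⊆ ∘ select-mono U (p⊆p∪q _)) (analytic-trans below′ ∘ below) ,
    X₀⊆ (∈-select⁺ U (x∈⁅x⁆ a)) , Y₀⊆ (∈-select⁺ U (x∈p∪q⁺ (inj₂ (x∈⁅x⁆ b))))
    where
    open Extension (extend _ _ marked-ab)
    below′ : Below (⟦ ⁅ a ⁆ ⟧ , ⟦ Y w ∪ ⁅ b ⁆ ⟧) (sequentOf w)
    below′ = Below-⊆ (select-⁅⁆ U) (select-∪⁅⁆ U)
               (Below-∷ˡ (Below-∷ʳ (⊆-Below (λ ()) ⊆-refl) (_ , inj₁ m , ⊑-≺r ⊑-refl))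
                         (_ , inj₁ m , ⊑-≺l ⊑-refl))

  open Forcing canonical

  forced : ∀ A {w} → A ∈ ⟦ X w ⟧ → w ⊩ A
  refuted : ∀ A {w} → A ∈ ⟦ Y w ⟧ → ¬ (w ⊩ A)

  forced (atom p) m = m
  forced top m = tt
  forced bot {w} m = absurd-basic w (⊥-left m)
  forced (A ∧ B) {w} m with decides w (inj₁ m) (⊑-∧l ⊑-refl) | decides w (inj₁ m) (⊑-∧r ⊑-refl)
  ... | inj₁ a | inj₁ b = forced A a , forced B b
  ... | inj₂ a | _ = ⊥-elim (absurd-basic w (∧-left₁ m a))
  ... | inj₁ _ | inj₂ b = ⊥-elim (absurd-basic w (∧-left₂ m b))
  forced (A ∨ B) {w} m with decides w (inj₁ m) (⊑-∨l ⊑-refl) | decides w (inj₁ m) (⊑-∨r ⊑-refl)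
  ... | inj₁ a | _ = inj₁ (forced A a)
  ... | inj₂ _ | inj₁ b = inj₂ (forced B b)
  ... | inj₂ a | inj₂ b = ⊥-elim (absurd-basic w (∨-left m a b))
  forced (A ⊃ B) m {w′} (X⊆X′ , _) ⊩A ⊮B with decides w′ (inj₁ (X⊆X′ m)) (⊑-⊃l ⊑-refl)
  ... | inj₂ a = refuted A a ⊩A
  ... | inj₁ a with decides w′ (inj₁ (X⊆X′ m)) (⊑-⊃r ⊑-refl)
  ...   | inj₁ b = ⊮B (forced B b)
  ...   | inj₂ b = absurd-basic w′ (⊃-left (X⊆X′ m) a b)
  forced (A ≺ B) {w} m with ≺-witness w m
  ... | w′ , w′≤w , a , b = w′ , w′≤w , forced A a , refuted B b

  refuted (atom p) {w} m ⊩p = absurd-basic w (shared ⊩p m)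
  refuted top {w} m _ = absurd-basic w (⊤-right m)
  refuted (A ∧ B) {w} m (⊩A , ⊩B)
    with decides w (inj₂ m) (⊑-∧l ⊑-refl) | decides w (inj₂ m) (⊑-∧r ⊑-refl)
  ... | inj₂ a | _ = refuted A a ⊩A
  ... | inj₁ _ | inj₂ b = refuted B b ⊩B
  ... | inj₁ a | inj₁ b = absurd-basic w (∧-right a b m)
  refuted (A ∨ B) {w} m (inj₁ ⊩A) with decides w (inj₂ m) (⊑-∨l ⊑-refl)
  ... | inj₁ a = absurd-basic w (∨-right₁ a m)
  ... | inj₂ a = refuted A a ⊩A
  refuted (A ∨ B) {w} m (inj₂ ⊩B) with decides w (inj₂ m) (⊑-∨r ⊑-refl)
  ... | inj₁ b = absurd-basic w (∨-right₂ b m)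
  ... | inj₂ b = refuted B b ⊩B
  refuted (A ⊃ B) {w} m ⊩A⊃B with ⊃-witness w m
  ... | w′ , w≤w′ , a , b = ⊩A⊃B {w′} w≤w′ (forced A a) (refuted B b)
  refuted (A ≺ B) m (w′ , (_ , Y⊆Y′) , ⊩A , ⊮B) with decides w′ (inj₂ (Y⊆Y′ m)) (⊑-≺l ⊑-refl)
  ... | inj₂ a = refuted A a ⊩A
  ... | inj₁ a with decides w′ (inj₂ (Y⊆Y′ m)) (⊑-≺r ⊑-refl)
  ...   | inj₁ b = ⊮B (forced B b)
  ...   | inj₂ b = absurd-basic w′ (≺-right a (Y⊆Y′ m) b)

  positions : Ctx → Subset (length U)
  positions Γ = Vec.tabulate λ i → does (formula i ∈? Γ)

  ⟦positions⟧⊆ : ∀ Γ → ⟦ positions Γ ⟧ ⊆ Γ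
  ⟦positions⟧⊆ Γ m with ∈-select⁻ U m
  ... | i , i∈ , refl
    with formula i ∈? Γ | trans (sym (Vecₚ.lookup∘tabulate _ i)) (Vecₚ.[]=⇒lookup i∈)
  ...   | yes C∈Γ | _ = C∈Γ
  ...   | no _ | ()

  ⊆⟦positions⟧ : ∀ {Γ} → Γ ⊆ U → Γ ⊆ ⟦ positions Γ ⟧
  ⊆⟦positions⟧ {Γ} Γ⊆U C∈Γ with locate (Γ⊆U C∈Γ)
  ... | i , refl = ∈-select⁺ U (Vecₚ.lookup⇒[]= i _
                     (trans (Vecₚ.lookup∘tabulate _ i) (dec-true (formula i ∈? Γ) C∈Γ)))

  completeness : ∀ {Γ Δ} → Γ ⊆ U → Δ ⊆ U → Γ ⊨ Δ → LocallyAnalyticProof Γ Δ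
  completeness {Γ} {Δ} Γ⊆U Δ⊆U valid with marked (positions Γ , positions Δ) in marked-ΓΔ
  ... | true = mono (⟦positions⟧⊆ Γ) (⟦positions⟧⊆ Δ) (marked-provable _ marked-ΓΔ)
  ... | false = ⊥-elim (valid canonical {world}
                  ( All.tabulate (λ {C} → forced C ∘ X₀⊆ ∘ ⊆⟦positions⟧ Γ⊆U)
                  , All.tabulate (λ {C} → refuted C ∘ Y₀⊆ ∘ ⊆⟦positions⟧ Δ⊆U)))
    where open Extension (extend _ _ marked-ΓΔ)

theorem2 : ∀ Γ Δ → BiIntProof Γ Δ → LocallyAnalyticProof Γ Δ
theorem2 Γ Δ p = completeness (⊆-subformulasOf ∘ ∈-++⁺ˡ) (⊆-subformulasOf ∘ ∈-++⁺ʳ Γ) (soundness p)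
  where open Canonical (subformulasOf (Γ ++ Δ)) (subformulasOf-closed (Γ ++ Δ))
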